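{- Let $G$ be a graph with domination number $1$ and let $H$ be a connected graph with $|V(G)|=|V(H)|=n$. Then $EC(G,H)\geq \left\lceil\frac{n-1}{\Delta}\right\rceil$, where $\Delta$ is the maximum degree of $H$.
   Context: All graphs are finite and simple. The domination number of $G$ is the minimum cardinality of a set $S\subseteq V(G)$ such that every vertex is in $S$ or adjacent to a vertex of $S$. An embedding of $G$ into $H$ is a pair $(f,P_f)$ where $f:V(G)\to V(H)$ is injective and $P_f$ assigns to each edge $uv\in E(G)$ a path $P_f(uv)$ in $H$ between $f(u)$ and $f(v)$. For $e\in E(H)$, $EC_f(e)=|\{xy\in E(G): e\in P_f(xy)\}|$, and $EC(G,H)=\min_{(f,P_f)}\max_{e\in E(H)} EC_f(e)$, the minimum over all embeddings. -}

module Defs where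

open import Data.Nat using (ℕ; zero; suc; _+_; _∸_; _≤_; _⊔_)
open import Data.Nat.DivMod using (_/_)
open import Data.Bool using (Bool; true; false; T; _∧_; _∨_; if_then_else_)
open import Data.Fin using (Fin; _<_; _<?_) renaming (_≟_ to _≟ᶠ_)
open import Data.Fin.Subset using (Subset; _∈_; ∣_∣)
open import Data.List using (List; []; _∷_; map; foldr; allFin; head; last; cartesianProduct; length; filter)
open import Data.List.Relation.Unary.Linked using (Linked)
open import Data.List.Relation.Unary.Unique.Propositional using (Unique)
open import Data.Maybe using (Maybe; just)
open import Data.Product using (_×_; _,_; Σ; ∃)
open import Data.Sum using (_⊎_)
open import Function.Definitions using (Injective)
open import Relation.Binary.PropositionalEquality using (_≡_)
open import Relation.Nullary.Decidable using (⌊_⌋)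

record Graph (n : ℕ) : Set where
  field
    adj      : Fin n → Fin n → Bool
    symmetric : ∀ u v → adj u v ≡ adj v u
    loopless  : ∀ v → adj v v ≡ false
open Graph public

Adj : ∀ {n} → Graph n → Fin n → Fin n → Set
Adj G u v = T (adj G u v)

Dominating : ∀ {n} → Graph n → Subset n → Set
Dominating {n} G S = ∀ (v : Fin n) → v ∈ S ⊎ (Σ (Fin n) λ w → w ∈ S × Adj G w v)

IsDominationNumber : ∀ {n} → Graph n → ℕ → Set
IsDominationNumber {n} G k =
  (Σ (Subset n) λ S → Dominating G S × ∣ S ∣ ≡ k) ×
  (∀ (S : Subset n) → Dominating G S → k ≤ ∣ S ∣)

IsPath : ∀ {n} → Graph n → Fin n → Fin n → List (Fin n) → Set
IsPath H s t p = head p ≡ just s × last p ≡ just t × Linked (Adj H) p × Unique p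

Connected : ∀ {n} → Graph n → Set
Connected {n} H = ∀ (u v : Fin n) → Σ (List (Fin n)) λ p → IsPath H u v p

degree : ∀ {n} → Graph n → Fin n → ℕ
degree {n} H v = length (filter (λ w → T? (adj H v w)) (allFin n))
  where
    open import Data.Bool.Properties using (T?)

maxDegree : ∀ {n} → Graph n → ℕ
maxDegree {n} H = foldr _⊔_ 0 (map (degree H) (allFin n))

-- Values of P on non-edges are irrelevant.
record Embedding {n : ℕ} (G H : Graph n) : Set where
  field
    f       : Fin n → Fin n
    f-inj   : Injective _≡_ _≡_ f
    P       : Fin n → Fin n → List (Fin n)
    P-path  : ∀ u v → u < v → Adj G u v → IsPath H (f u) (f v) (P u v)
open Embedding public

_==_ : ∀ {n} → Fin n → Fin n → Bool
x == y = ⌊ x ≟ᶠ y ⌋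

usesEdge : ∀ {n} → Fin n → Fin n → List (Fin n) → Bool
usesEdge a b [] = false
usesEdge a b (x ∷ []) = false
usesEdge a b (x ∷ y ∷ p) =
  ((x == a ∧ y == b) ∨ (x == b ∧ y == a)) ∨ usesEdge a b (y ∷ p)

allPairs : ∀ n → List (Fin n × Fin n)
allPairs n = cartesianProduct (allFin n) (allFin n)

isEdge : ∀ {n} → Graph n → Fin n × Fin n → Bool
isEdge G (u , v) = ⌊ u <? v ⌋ ∧ adj G u v

-- EC_f(e) for the edge e = {a,b} of H: number of edges xy of G with e ∈ P_f(xy)
EC-edge : ∀ {n} {G H : Graph n} → Embedding G H → Fin n → Fin n → ℕ
EC-edge {n} {G} φ a b =
  length (filter (λ uv → Data.Bool.Properties.T? (isEdge G uv ∧ usesEdge a b (P φ (Data.Product.proj₁ uv) (Data.Product.proj₂ uv)))) (allPairs n))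
  where import Data.Bool.Properties

-- max over edges e of H of EC_f(e)  (0 if H has no edges)
maxEC : ∀ {n} {G H : Graph n} → Embedding G H → ℕ
maxEC {n} {G} {H} φ =
  foldr _⊔_ 0 (map (λ ab → if isEdge H ab then EC-edge φ (Data.Product.proj₁ ab) (Data.Product.proj₂ ab) else 0) (allPairs n))

IsEC : ∀ {n} → Graph n → Graph n → ℕ → Set
IsEC G H k = (Σ (Embedding G H) λ φ → maxEC φ ≡ k) × (∀ (φ : Embedding G H) → k ≤ maxEC φ)

-- ceiling division; convention ⌈a/0⌉ = 0 (only relevant when n = 1)
⌈_/_⌉ : ℕ → ℕ → ℕ
⌈ a / zero ⌉ = 0
⌈ a / suc d ⌉ = (a + d) / suc d

module Submission where

-- If γ(G) = 1, some vertex w of G is adjacent to every other vertex,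
-- so G has the n-1 edges wv (v ≠ w).  In any embedding f of G into H the
-- path routing wv starts or ends at f(w), hence traverses one of the at most
-- Δ(H) edges of H incident to f(w).  Double counting gives
--      n - 1 ≤ Σ_{y ~ f(w)} EC_f(f(w)y) ≤ deg_H(f(w)) · maxEC(f) ≤ Δ(H) · maxEC(f),
-- and dividing (with ceiling) yields the claim for an optimal embedding.

open import Defs
open import Data.Nat using (ℕ; _≤_; _∸_; zero; suc; _+_; _*_; _⊔_; z≤n; s≤s)
open import Data.Nat.Properties as NP using (≤-refl; ≤-trans; module ≤-Reasoning)
open import Data.Nat.DivMod using (m<n*o⇒m/o<n)
open import Data.Nat.ListAction using (sum)
open import Data.Bool using (Bool; true; false; T; _∧_; _∨_; if_then_else_)
open import Data.Bool.Properties using (T?; T-∧; T-∨; ∨-comm)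
open import Data.Fin as F using (Fin; _<?_)
import Data.Fin.Properties as FP
open import Data.Fin.Subset as S using (Subset; inside; outside; ∣_∣)
open import Data.Vec.Base as V using (_∷_)
open import Data.List as L using (List; []; _∷_; length; filter; map; foldr; allFin)
open import Data.List.Properties using (length-map; length-tabulate; length-removeAt′; filter-≐)
open import Data.List.Relation.Unary.Any as Any using (here; there)
open import Data.List.Relation.Unary.All as All using ()
open import Data.List.Relation.Unary.AllPairs using (_∷_)
open import Data.List.Relation.Unary.Linked using (Linked; _∷_)
open import Data.List.Relation.Unary.Unique.Propositional using (Unique)
import Data.List.Relation.Unary.Unique.Propositional.Properties as Unique
open import Data.List.Relation.Binary.Subset.Propositional using (_⊆_)
open import Data.List.Membership.Propositional using (_∈_)
open import Data.List.Membership.Propositional.Properties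
  using (∈-map⁻; ∈-filter⁺; ∈-filter⁻; ∈-allFin; ∈-cartesianProduct⁺)
open import Data.Maybe using (just)
open import Data.Maybe.Properties using (just-injective)
open import Data.Product using (_×_; _,_; Σ; proj₁; proj₂)
open import Data.Sum using (_⊎_; inj₁; inj₂)
open import Data.Empty using (⊥-elim)
open import Function using (_∘_)
open import Function.Bundles using (Equivalence)
open import Relation.Binary using (tri<; tri≈; tri>)
open import Relation.Binary.PropositionalEquality
open import Relation.Nullary using (¬_; yes; no; ¬?)
open import Relation.Nullary.Decidable using (⌊_⌋; fromWitness)

-- Number of elements of a list satisfying a Boolean test; degree and EC-edge
-- of Defs are instances of it (definitionally).
count : ∀ {A : Set} → (A → Bool) → List A → ℕ
count b xs = length (filter (λ x → T? (b x)) xs)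

module _ {A : Set} where

  ∈-─ : ∀ {x z : A} {ys} (z∈ys : z ∈ ys) → x ∈ ys → ¬ x ≡ z → x ∈ (ys Any.─ z∈ys)
  ∈-─ (here refl) (here refl) x≢z = ⊥-elim (x≢z refl)
  ∈-─ (here refl) (there x∈ys) _   = x∈ys
  ∈-─ (there _)   (here refl) _    = here refl
  ∈-─ (there z∈ys) (there x∈ys) x≢z = there (∈-─ z∈ys x∈ys x≢z)

  unique-⊆-length : ∀ {xs ys : List A} → Unique xs → xs ⊆ ys → length xs ≤ length ys
  unique-⊆-length {[]}     _                 _  = z≤n
  unique-⊆-length {x ∷ xs} {ys} (x∉xs ∷ uniq) xs⊆ys = begin
    suc (length xs)                     ≤⟨ s≤s (unique-⊆-length uniq xs⊆ys─x) ⟩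
    suc (length (ys Any.─ x∈ys))        ≡⟨ length-removeAt′ ys (Any.index x∈ys) ⟨
    length ys                           ∎
    where
    open ≤-Reasoning
    x∈ys = xs⊆ys (here refl)
    xs⊆ys─x : xs ⊆ (ys Any.─ x∈ys)
    xs⊆ys─x y∈xs = ∈-─ x∈ys (xs⊆ys (there y∈xs)) (λ y≡x → All.lookup x∉xs y∈xs (sym y≡x))

  last-∈ : ∀ {t : A} p → L.last p ≡ just t → t ∈ p
  last-∈ (x ∷ [])     refl = here refl
  last-∈ (x ∷ y ∷ p)  eq   = there (last-∈ (y ∷ p) eq)

  count-cong : ∀ (b₁ b₂ : A → Bool) → (∀ x → b₁ x ≡ b₂ x) → ∀ xs → count b₁ xs ≡ count b₂ xs
  count-cong b₁ b₂ eq xs =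
    cong length (filter-≐ (T? ∘ b₁) (T? ∘ b₂) ((λ {x} → subst T (eq x)) , (λ {x} → subst T (sym (eq x)))) xs)

  count-∷ : ∀ (b : A → Bool) x xs → count b xs ≤ count b (x ∷ xs)
  count-∷ b x xs with b x
  ... | true  = NP.n≤1+n _
  ... | false = ≤-refl

  count-∷-strict : ∀ (b : A → Bool) x xs → T (b x) → suc (count b xs) ≤ count b (x ∷ xs)
  count-∷-strict b x xs bx with b x
  ... | true = ≤-refl

module _ {B : Set} where

  sum-mono : ∀ (g h : B → ℕ) → (∀ y → g y ≤ h y) → ∀ ys → sum (map g ys) ≤ sum (map h ys)
  sum-mono g h g≤h []       = z≤n
  sum-mono g h g≤h (y ∷ ys) = NP.+-mono-≤ (g≤h y) (sum-mono g h g≤h ys)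

  sum-mono-strict : ∀ (g h : B → ℕ) → (∀ y → g y ≤ h y) → ∀ {y₀} ys → y₀ ∈ ys →
    suc (g y₀) ≤ h y₀ → suc (sum (map g ys)) ≤ sum (map h ys)
  sum-mono-strict g h g≤h (y ∷ ys) (here refl) lt = NP.+-mono-≤ lt (sum-mono g h g≤h ys)
  sum-mono-strict g h g≤h (y ∷ ys) (there y₀∈ys) lt = begin
    suc (g y + sum (map g ys))  ≡⟨ NP.+-suc (g y) _ ⟨
    g y + suc (sum (map g ys))  ≤⟨ NP.+-mono-≤ (g≤h y) (sum-mono-strict g h g≤h ys y₀∈ys lt) ⟩
    h y + sum (map h ys)        ∎
    where open ≤-Reasoning

  sum-≤-length* : ∀ (g : B → ℕ) M ys → (∀ {y} → y ∈ ys → g y ≤ M) → sum (map g ys) ≤ length ys * M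
  sum-≤-length* g M []       _     = z≤n
  sum-≤-length* g M (y ∷ ys) g≤M = NP.+-mono-≤ (g≤M (here refl)) (sum-≤-length* g M ys (g≤M ∘ there))

  ≤-max : ∀ (g : B → ℕ) {y} ys → y ∈ ys → g y ≤ foldr _⊔_ 0 (map g ys)
  ≤-max g (y ∷ ys) (here refl)  = NP.m≤m⊔n (g y) _
  ≤-max g (y ∷ ys) (there y∈ys) = ≤-trans (≤-max g ys y∈ys) (NP.m≤n⊔m (g y) _)

  count-cover : ∀ {A : Set} (r : B → A → Bool) (ys : List B) (xs : List A) →
    (∀ {x} → x ∈ xs → Σ B λ y → y ∈ ys × T (r y x)) →
    length xs ≤ sum (map (λ y → count (r y) xs) ys)
  count-cover r ys []       _     = z≤n
  count-cover r ys (x ∷ xs) cover with cover (here refl)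
  ... | y₀ , y₀∈ys , ry₀x = begin-strict
    length xs                                 ≤⟨ count-cover r ys xs (cover ∘ there) ⟩
    sum (map (λ y → count (r y) xs) ys)       <⟨ sum-mono-strict _ _ (λ y → count-∷ (r y) x xs) ys y₀∈ys
                                                   (count-∷-strict (r y₀) x xs ry₀x) ⟩
    sum (map (λ y → count (r y) (x ∷ xs)) ys) ∎
    where open ≤-Reasoning

∣p∣≡0⇒∉ : ∀ {k} (p : Subset k) {x} → ∣ p ∣ ≡ 0 → ¬ (x S.∈ p)
∣p∣≡0⇒∉ (inside ∷ p)  ()
∣p∣≡0⇒∉ (outside ∷ p) eq (V.there x∈p) = ∣p∣≡0⇒∉ p eq x∈p

∣p∣≡1⇒singleton : ∀ {k} (p : Subset k) → ∣ p ∣ ≡ 1 →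
  Σ (Fin k) λ x → x S.∈ p × (∀ {y} → y S.∈ p → y ≡ x)
∣p∣≡1⇒singleton (inside ∷ p) eq = F.zero , V.here , only
  where
  only : ∀ {y} → y S.∈ inside ∷ p → y ≡ F.zero
  only V.here          = refl
  only (V.there y∈p)   = ⊥-elim (∣p∣≡0⇒∉ p (NP.suc-injective eq) y∈p)
∣p∣≡1⇒singleton (outside ∷ p) eq with ∣p∣≡1⇒singleton p eq
... | x , x∈p , only = F.suc x , V.there x∈p , λ { (V.there y∈p) → cong F.suc (only y∈p) }

universal-vertex : ∀ {n} (G : Graph n) → IsDominationNumber G 1 →
  Σ (Fin n) λ w → ∀ v → ¬ v ≡ w → Adj G w v
universal-vertex G ((D , dominating , ∣D∣≡1) , _) with ∣p∣≡1⇒singleton D ∣D∣≡1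
... | w , _ , only = w , adjacent
  where
  adjacent : ∀ v → ¬ v ≡ w → Adj G w v
  adjacent v v≢w with dominating v
  ... | inj₁ v∈D              = ⊥-elim (v≢w (only v∈D))
  ... | inj₂ (u , u∈D , u~v)  = subst (λ u → Adj G u v) (only u∈D) u~v

T-== : ∀ {n} (x : Fin n) → T (x == x)
T-== x = fromWitness refl

T-∨ˡ : ∀ a b → T a → T (a ∨ b)
T-∨ˡ a b = Equivalence.from (T-∨ {a} {b}) ∘ inj₁

T-∨ʳ : ∀ a b → T b → T (a ∨ b)
T-∨ʳ a b = Equivalence.from (T-∨ {a} {b}) ∘ inj₂

both-refl : ∀ {n} (x y : Fin n) → T ((x == x) ∧ (y == y))
both-refl x y = Equivalence.from (T-∧ {x == x} {y == y}) (T-== x , T-== y)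

uses-first-edge : ∀ {n} (x y : Fin n) r → T (usesEdge x y (x ∷ y ∷ r))
uses-first-edge x y r = T-∨ˡ _ (usesEdge x y (y ∷ r))
  (T-∨ˡ ((x == x) ∧ (y == y)) ((x == y) ∧ (y == x)) (both-refl x y))

uses-first-edge-reversed : ∀ {n} (x y : Fin n) r → T (usesEdge y x (x ∷ y ∷ r))
uses-first-edge-reversed x y r = T-∨ˡ _ (usesEdge y x (y ∷ r))
  (T-∨ʳ ((x == y) ∧ (y == x)) ((x == x) ∧ (y == y)) (both-refl x y))

uses-later-edge : ∀ {n} (a b : Fin n) x y r → T (usesEdge a b (y ∷ r)) → T (usesEdge a b (x ∷ y ∷ r))
uses-later-edge a b x y r = T-∨ʳ ((x == a ∧ y == b) ∨ (x == b ∧ y == a)) (usesEdge a b (y ∷ r))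

usesEdge-sym : ∀ {n} (a b : Fin n) p → usesEdge a b p ≡ usesEdge b a p
usesEdge-sym a b []          = refl
usesEdge-sym a b (x ∷ [])    = refl
usesEdge-sym a b (x ∷ y ∷ p) =
  cong₂ _∨_ (∨-comm ((x == a) ∧ (y == b)) ((x == b) ∧ (y == a))) (usesEdge-sym a b (y ∷ p))

Adj-sym : ∀ {n} (G : Graph n) {a b : Fin n} → Adj G a b → Adj G b a
Adj-sym G {a} {b} = subst T (symmetric G a b)

isEdge-intro : ∀ {n} (G : Graph n) {a b : Fin n} → a F.< b → Adj G a b → T (isEdge G (a , b))
isEdge-intro G {a} {b} a<b a~b with a <? b
... | yes _   = a~b
... | no a≮b  = ⊥-elim (a≮b a<b)

∈-allPairs : ∀ {n} (ab : Fin n × Fin n) → ab ∈ allPairs n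
∈-allPairs (a , b) = ∈-cartesianProduct⁺ (∈-allFin a) (∈-allFin b)

module Walks {n : ℕ} (H : Graph n) where

  walk-vertex-on-edge : ∀ {s} x y r → Linked (Adj H) (x ∷ y ∷ r) → s ∈ x ∷ y ∷ r →
    Σ (Fin n) λ z → Adj H s z × T (usesEdge s z (x ∷ y ∷ r))
  walk-vertex-on-edge x y r       (x~y ∷ _) (here refl)         = y , x~y , uses-first-edge x y r
  walk-vertex-on-edge x y []      (x~y ∷ _) (there (here refl)) =
    x , Adj-sym H x~y , uses-first-edge-reversed x y []
  walk-vertex-on-edge x y (z ∷ r) (_ ∷ linked) (there s∈) with walk-vertex-on-edge y z r linked s∈
  ... | u , s~u , uses = u , s~u , uses-later-edge _ _ x y (z ∷ r) uses

  path-edge-at-endpoint : ∀ {s t u} p → IsPath H s t p → ¬ s ≡ t → u ≡ s ⊎ u ≡ t →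
    Σ (Fin n) λ z → Adj H u z × T (usesEdge u z p)
  path-edge-at-endpoint []          (() , _)
  path-edge-at-endpoint (x ∷ [])    (refl , refl , _) s≢t _ = ⊥-elim (s≢t refl)
  path-edge-at-endpoint (x ∷ y ∷ r) (h , l , linked , _) _ endpoint =
    walk-vertex-on-edge x y r linked (u∈ endpoint)
    where
    u∈ : ∀ {u} → u ≡ _ ⊎ u ≡ _ → u ∈ x ∷ y ∷ r
    u∈ (inj₁ refl) = here (sym (just-injective h))
    u∈ (inj₂ refl) = last-∈ (x ∷ y ∷ r) l

module Congestion {n : ℕ} {G H : Graph n} (φ : Embedding G H) where

  EC-edge-sym : ∀ a b → EC-edge φ a b ≡ EC-edge φ b a
  EC-edge-sym a b = count-cong _ _
    (λ uv → cong (isEdge G uv ∧_) (usesEdge-sym a b (P φ (proj₁ uv) (proj₂ uv)))) (allPairs n)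

  EC-edge≤maxEC-ordered : ∀ a b → T (isEdge H (a , b)) → EC-edge φ a b ≤ maxEC φ
  EC-edge≤maxEC-ordered a b edge
    with isEdge H (a , b) | ≤-max (λ ab → if isEdge H ab then EC-edge φ (proj₁ ab) (proj₂ ab) else 0)
                                  (allPairs n) (∈-allPairs (a , b))
  ... | true | bound = bound

  EC-edge≤maxEC : ∀ a b → Adj H a b → EC-edge φ a b ≤ maxEC φ
  EC-edge≤maxEC a b a~b with FP.<-cmp a b
  ... | tri< a<b _ _  = EC-edge≤maxEC-ordered a b (isEdge-intro H a<b a~b)
  ... | tri≈ _ refl _ = ⊥-elim (subst T (loopless H a) a~b)
  ... | tri> _ _ b<a  = subst (_≤ maxEC φ) (EC-edge-sym b a)
                          (EC-edge≤maxEC-ordered b a (isEdge-intro H b<a (Adj-sym H a~b)))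

module UniversalVertex {n : ℕ} (G H : Graph n) (φ : Embedding G H) (w : Fin n)
                       (w-universal : ∀ v → ¬ v ≡ w → Adj G w v) where

  open Congestion φ

  pair : Fin n → Fin n × Fin n
  pair v = if ⌊ w <? v ⌋ then (w , v) else (v , w)

  route : Fin n → List (Fin n)
  route v = P φ (proj₁ (pair v)) (proj₂ (pair v))

  pair-cases : ∀ v → (w F.< v × pair v ≡ (w , v)) ⊎ (¬ w F.< v × pair v ≡ (v , w))
  pair-cases v with w <? v
  ... | yes w<v = inj₁ (w<v , refl)
  ... | no  w≮v = inj₂ (w≮v , refl)

  -- Distinct vertices give distinct pairs, so edges wv are not counted twice.
  pair-injective : ∀ {x y} → pair x ≡ pair y → x ≡ y
  pair-injective {x} {y} eq with pair-cases x | pair-cases y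
  ... | inj₁ (_ , px) | inj₁ (_ , py) = cong proj₂ (trans (sym px) (trans eq py))
  ... | inj₂ (_ , px) | inj₂ (_ , py) = cong proj₁ (trans (sym px) (trans eq py))
  ... | inj₁ (_ , px) | inj₂ (_ , py) =
    let wx≡yw = trans (sym px) (trans eq py) in trans (cong proj₂ wx≡yw) (cong proj₁ wx≡yw)
  ... | inj₂ (_ , px) | inj₁ (_ , py) =
    let xw≡wy = trans (sym px) (trans eq py) in trans (cong proj₁ xw≡wy) (cong proj₂ xw≡wy)

  below-w : ∀ {v} → ¬ v ≡ w → ¬ w F.< v → v F.< w
  below-w v≢w w≮v = FP.≤∧≢⇒< (NP.≮⇒≥ w≮v) v≢w

  pair-isEdge : ∀ v → ¬ v ≡ w → T (isEdge G (pair v))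
  pair-isEdge v v≢w with pair-cases v
  ... | inj₁ (w<v , eq) rewrite eq = isEdge-intro G w<v (w-universal v v≢w)
  ... | inj₂ (w≮v , eq) rewrite eq =
    isEdge-intro G (below-w v≢w w≮v) (Adj-sym G (w-universal v v≢w))

  route-leaves-centre : ∀ v → ¬ v ≡ w →
    Σ (Fin n) λ z → Adj H (f φ w) z × T (usesEdge (f φ w) z (route v))
  route-leaves-centre v v≢w with pair-cases v
  ... | inj₁ (w<v , eq) rewrite eq =
    Walks.path-edge-at-endpoint H (P φ w v) (P-path φ w v w<v (w-universal v v≢w))
      (λ fw≡fv → v≢w (sym (f-inj φ fw≡fv))) (inj₁ refl)
  ... | inj₂ (w≮v , eq) rewrite eq =
    Walks.path-edge-at-endpoint H (P φ v w)
      (P-path φ v w (below-w v≢w w≮v) (Adj-sym G (w-universal v v≢w)))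
      (λ fv≡fw → v≢w (f-inj φ fv≡fw)) (inj₂ refl)

  others : List (Fin n)
  others = filter (λ v → ¬? (v F.≟ w)) (allFin n)

  ≢w-of-others : ∀ {v} → v ∈ others → ¬ v ≡ w
  ≢w-of-others v∈ = proj₂ (∈-filter⁻ (λ v → ¬? (v F.≟ w)) {xs = allFin n} v∈)

  n≤1+|others| : n ≤ suc (length others)
  n≤1+|others| = subst (_≤ suc (length others)) (length-tabulate (λ v → v))
    (unique-⊆-length (Unique.allFin⁺ n) allFin⊆w∷others)
    where
    allFin⊆w∷others : allFin n ⊆ w ∷ others
    allFin⊆w∷others {v} v∈ with v F.≟ w
    ... | yes refl = here refl
    ... | no  v≢w  = there (∈-filter⁺ (λ v → ¬? (v F.≟ w)) v∈ v≢w)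

  through : Fin n → Fin n → Bool
  through y v = usesEdge (f φ w) y (route v)

  count-through≤EC : ∀ y → count (through y) others ≤ EC-edge φ (f φ w) y
  count-through≤EC y = subst (_≤ EC-edge φ (f φ w) y) (length-map pair selected)
    (unique-⊆-length (Unique.map⁺ pair-injective
      (Unique.filter⁺ (T? ∘ through y) (Unique.filter⁺ (λ v → ¬? (v F.≟ w)) (Unique.allFin⁺ n))))
      pairs⊆)
    where
    selected = filter (T? ∘ through y) others
    pairs⊆ : map pair selected ⊆ filter _ (allPairs n)
    pairs⊆ z∈ with ∈-map⁻ pair z∈
    ... | v , v∈ , refl with ∈-filter⁻ (T? ∘ through y) {xs = others} v∈
    ...   | v∈others , uses = ∈-filter⁺ _ (∈-allPairs (pair v))
              (Equivalence.from T-∧ (pair-isEdge v (≢w-of-others v∈others) , uses))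

  congestion-bound : n ∸ 1 ≤ maxDegree H * maxEC φ
  congestion-bound = begin
    n ∸ 1                                                 ≤⟨ NP.∸-monoˡ-≤ 1 n≤1+|others| ⟩
    length others                                         ≤⟨ count-cover through neighbours others cover ⟩
    sum (map (λ y → count (through y) others) neighbours) ≤⟨ sum-≤-length* _ (maxEC φ) neighbours bounded ⟩
    degree H (f φ w) * maxEC φ                            ≤⟨ NP.*-monoˡ-≤ (maxEC φ)
                                                               (≤-max (degree H) (allFin n) (∈-allFin (f φ w))) ⟩
    maxDegree H * maxEC φ                                 ∎
    where
    open ≤-Reasoning
    neighbours : List (Fin n)
    neighbours = filter (λ y → T? (adj H (f φ w) y)) (allFin n)
    cover : ∀ {v} → v ∈ others → Σ (Fin n) λ y → y ∈ neighbours × T (through y v)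
    cover v∈ with route-leaves-centre _ (≢w-of-others v∈)
    ... | y , fw~y , uses = y , ∈-filter⁺ (λ y → T? (adj H (f φ w) y)) (∈-allFin y) fw~y , uses
    bounded : ∀ {y} → y ∈ neighbours → count (through y) others ≤ maxEC φ
    bounded {y} y∈ = ≤-trans (count-through≤EC y)
      (EC-edge≤maxEC (f φ w) y (proj₂ (∈-filter⁻ (λ y → T? (adj H (f φ w) y)) {xs = allFin n} y∈)))

⌈/⌉-least : ∀ a D M → a ≤ D * M → ⌈ a / D ⌉ ≤ M
⌈/⌉-least a zero    M _     = z≤n
⌈/⌉-least a (suc d) M a≤D*M = NP.≤-pred (m<n*o⇒m/o<n (s≤s a+d≤))
  where
  open ≤-Reasoning
  a+d≤ : a + d ≤ d + M * suc d
  a+d≤ = begin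
    a + d              ≤⟨ NP.+-monoˡ-≤ d (subst (a ≤_) (NP.*-comm (suc d) M) a≤D*M) ⟩
    M * suc d + d      ≡⟨ NP.+-comm (M * suc d) d ⟩
    d + M * suc d      ∎

lemma2 : ∀ (n : ℕ) (G H : Graph n) → IsDominationNumber G 1 → Connected H →
    ∀ (ec : ℕ) → IsEC G H ec → ⌈ n ∸ 1 / maxDegree H ⌉ ≤ ec
lemma2 n G H γ≡1 _ ec ((φ , maxEC≡ec) , _) with universal-vertex G γ≡1
... | w , w-universal = subst (⌈ n ∸ 1 / maxDegree H ⌉ ≤_) maxEC≡ec
  (⌈/⌉-least (n ∸ 1) (maxDegree H) (maxEC φ) (UniversalVertex.congestion-bound G H φ w w-universal))
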